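{- Let $\mathbb{F}$ be a field, let $M\subseteq\mathbb{F}^n$ be a set of size $|M|=m$, let $A\in\mathbb{F}^{m\times n}$ be the matrix whose rows are the vectors of $M$, and let $V\subseteq\mathbb{F}^m$ be the column space of $A$. Let $s,t$ be positive integers. The following are equivalent: (1) there is an $(s,t)$ linear data structure computing $A$; (2) $D_V(t)\leq s$; (3) $M$ is not $(s,t)$-sumset evasive.
   Context: A matrix is $t$-row sparse if each of its rows has at most $t$ non-zero entries. A subspace $U\subseteq\mathbb{F}^m$ is $t$-sparse if it is the column space of some $t$-row sparse matrix with $m$ rows. The outer dimension of a subspace $V\subseteq\mathbb{F}^m$ is $D_V(t)=\min\{\dim U : V\subseteq U,\ U \text{ is } t\text{ -sparse}\}$. An $(s,t)$ linear data structure computing $A\in\mathbb{F}^{m\times n}$ is a pair of linear maps $P:\mathbb{F}^n\to\mathbb{F}^s$ (preprocessing) and $Q:\mathbb{F}^s\to\mathbb{F}^m$ (query) with $Q(P(x))=Ax$ for all $x\in\mathbb{F}^n$, where each output coordinate of $Q$ depends on at most $t$ coordinates of its input; equivalently $A=QP$ with $Q\in\mathbb{F}^{m\times s}$ $t$-row sparse and $P\in\mathbb{F}^{s\times n}$. For $S\subseteq\mathbb{F}^n$, $tS=\{w_1s_1+\dots+w_ts_t : w_i\in\mathbb{F}, s_i\in S\}$. A set $M\subseteq\mathbb{F}^n$ with $|M|=m$ is $(s,t)$-sumset evasive if for every $S\subseteq\mathbb{F}^n$ with $|S|=s$ we have $|tS\cap M|<m$. -}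

module Defs where

open import Level using (Level; _⊔_; suc; Lift)
open import Algebra.Bundles using (CommutativeRing)
open import Data.Nat using (ℕ; _≤_)
open import Data.Fin using (Fin)
open import Data.List using (List; length)
open import Data.List.Membership.Propositional using (_∈_)
open import Data.Product using (Σ; ∃; ∃-syntax; _×_)
open import Relation.Nullary using (¬_)
open import Relation.Binary.PropositionalEquality using (_≡_)

record Field (c ℓ : Level) : Set (suc (c ⊔ ℓ)) where
  field
    commutativeRing : CommutativeRing c ℓ
  open CommutativeRing commutativeRing public
  field
    0≉1     : ¬ (0# ≈ 1#)
    inverse : ∀ x → ¬ (x ≈ 0#) → Σ Carrier (λ y → (x * y) ≈ 1#)

module LinAlg {c ℓ : Level} (F : Field c ℓ) where
  open Field F
  open import Algebra.Definitions.RawMonoid (CommutativeRing.+-rawMonoid commutativeRing)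
    using (sum)

  Vect : ℕ → Set c
  Vect n = Fin n → Carrier

  Mat : ℕ → ℕ → Set c
  Mat m n = Fin m → Fin n → Carrier

  _≋_ : ∀ {n} → Vect n → Vect n → Set ℓ
  u ≋ v = ∀ i → u i ≈ v i

  0v : ∀ {n} → Vect n
  0v _ = 0#

  _·_ : ∀ {m n} → Mat m n → Vect n → Vect m
  (A · x) i = sum (λ j → A i j * x j)

  lincomb : ∀ {d n} → (Fin d → Carrier) → (Fin d → Vect n) → Vect n
  lincomb w b j = sum (λ k → w k * b k j)

  Subset : ℕ → Set (suc (c ⊔ ℓ))
  Subset m = Vect m → Set (c ⊔ ℓ)

  _⊆_ : ∀ {m} → Subset m → Subset m → Set (c ⊔ ℓ)
  U ⊆ W = ∀ v → U v → W v

  ColSpace : ∀ {m k} → Mat m k → Subset m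
  ColSpace A v = ∃[ x ] (v ≋ (A · x))

  RowSparse : ∀ {m k} → ℕ → Mat m k → Set ℓ
  RowSparse {k = k} t Q =
    ∀ i → ∃[ L ] (length {A = Fin k} L ≤ t × (∀ j → ¬ (j ∈ L) → Q i j ≈ 0#))

  LinIndep : ∀ {d m} → (Fin d → Vect m) → Set (c ⊔ ℓ)
  LinIndep b = ∀ w → lincomb w b ≋ 0v → ∀ k → w k ≈ 0#

  IsBasis : ∀ {d m} → Subset m → (Fin d → Vect m) → Set (c ⊔ ℓ)
  IsBasis U b = LinIndep b × (∀ k → U (b k)) × (∀ v → U v → ∃[ w ] (v ≋ lincomb w b))

  HasDim : ∀ {m} → Subset m → ℕ → Set (c ⊔ ℓ)
  HasDim {m} U d = ∃[ b ] IsBasis {d} {m} U b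

  SparseSubspace : ∀ {m} → ℕ → Subset m → Set (c ⊔ ℓ)
  SparseSubspace {m} t U =
    ∃[ k ] ∃[ Q ] (RowSparse {m} {k} t Q × (∀ v → (U v → ColSpace Q v) × (ColSpace Q v → U v)))

  -- D_V(t) = d : d is the minimum of dim U over t-sparse U ⊇ V
  IsOuterDim : ∀ {m} → Subset m → ℕ → ℕ → Set (suc (c ⊔ ℓ))
  IsOuterDim V t d =
    (∃[ U ] (SparseSubspace t U × V ⊆ U × HasDim U d))
    × (∀ U d′ → SparseSubspace t U → V ⊆ U → HasDim U d′ → d ≤ d′)

  -- (s,t) linear data structure computing A : A = Q P as linear maps,
  -- P : F^n → F^s, Q : F^s → F^m with Q t-row sparse
  LinearDS : ∀ {m n} → ℕ → ℕ → Mat m n → Set (c ⊔ ℓ)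
  LinearDS {m} {n} s t A =
    ∃[ Q ] ∃[ P ] (RowSparse {m} {s} t Q × (∀ x → (Q · (P · x)) ≋ (A · x)))

  InRows : ∀ {m n} → Mat m n → Subset n
  InRows A v = Lift c (∃[ i ] (v ≋ A i))

  -- tS for a set S = {S_0,...,S_{s-1}} (|S| ≤ s)
  InSumset : ∀ {s n} → ℕ → (Fin s → Vect n) → Subset n
  InSumset {s} t S v =
    Σ (Fin t → Fin s) λ ι → Σ (Fin t → Carrier) λ w → v ≋ lincomb w (λ k → S (ι k))

  -- |X| < m : there is no family of m pairwise distinct elements of X
  CardLt : ∀ {n} → Subset n → ℕ → Set (c ⊔ ℓ)
  CardLt {n} X m =
    ¬ (Σ (Fin m → Vect n) λ f → ((∀ k l → f k ≋ f l → k ≡ l) × (∀ k → X (f k))))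

  -- M = rows of A (|M| = m) is (s,t)-sumset evasive:
  -- for every S with |S| ≤ s, |tS ∩ M| < m
  SumsetEvasive : ∀ {m n} → ℕ → ℕ → Mat m n → Set (c ⊔ ℓ)
  SumsetEvasive {m} {n} s t A =
    ∀ (S : Fin s → Vect n) → CardLt (λ v → InSumset t S v × InRows A v) m

-- Both equivalences pass through a reformulation of (1).
-- (1) ⇔ (2): a data structure A = QP is the same as a "sparse cover": a t-row sparse
-- Q with s columns whose column space contains V (P records coordinates of the
-- columns of A).  A sparse cover has a column space of dimension ≤ s (extract an
-- independent spanning subfamily of columns), so the least such dimension D_V(t) is
-- ≤ s.  Conversely, if a t-sparse U = ColSpace Q ⊇ V has dimension d ≤ s, the exchange
-- lemma (Gaussian elimination) selects ≤ d distinct columns of Q spanning all columns;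
-- they form a t-row sparse cover, padded with zero columns to s columns.
-- (1) ⇔ (3): writing each row of A as a t-sparse combination of the rows S of P is
-- the same as putting every row of A into tS; and since the m rows are distinct, M
-- fails to be sumset evasive exactly when all of M lies in some tS.
module Submission where

open import Defs
open import Level using (_⊔_; Lift; lift; lower)
open import Axiom.ExcludedMiddle using (ExcludedMiddle)
open import Data.Nat using (ℕ; zero; suc; _≤_; _<_; z≤n; s≤s; s≤s⁻¹; _≤′_; ≤′-refl; ≤′-step)
open import Data.Fin using (Fin; zero; suc; punchIn; punchOut)
open import Data.Nat.Properties using (m≤n⇒m≤1+n; ≤-reflexive; ≤-trans; ≤⇒≤′; 1+n≰n; n<1+n; m<n⇒m<1+n; ≤∧≢⇒<)
open import Data.List using (List; []; _∷_; length; tabulate; map)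
open import Data.List.Properties using (length-tabulate; length-map)
open import Data.List.Membership.Propositional using (_∈_)
open import Data.List.Membership.Propositional.Properties using (∈-tabulate⁺; ∈-map⁺)
open import Data.List.Relation.Unary.Any using (here; there)
open import Data.Fin.Properties using (_≟_; any?; punchInᵢ≢i; punchIn-injective; punchIn-punchOut; punchOut-injective; injective⇒≤)
open import Data.Vec.Functional using () renaming (_∷_ to _∷ᶠ_)
open import Data.Product using (Σ; ∃-syntax; _×_; _,_; proj₁; proj₂)
open import Data.Sum using (_⊎_; inj₁; inj₂)
open import Function.Base using (_∘_; id)
open import Function.Bundles using (_⇔_; mk⇔; Equivalence)
open import Function.Construct.Composition using (_⇔-∘_)
open import Function.Construct.Symmetry using (⇔-sym)
open import Relation.Nullary using (¬_; Dec; yes; no; ¬?; contradiction)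
open import Relation.Nullary.Decidable using (decidable-stable)
open import Relation.Binary.PropositionalEquality as ≡ using (_≡_; _≢_)

preimage : ∀ {r k} → (Fin r → Fin k) → List (Fin k) → List (Fin r)
preimage σ []      = []
preimage σ (a ∷ L) with any? (λ l → σ l ≟ a)
... | yes (l , _) = l ∷ preimage σ L
... | no  _       = preimage σ L

preimage-length : ∀ {r k} (σ : Fin r → Fin k) (L : List (Fin k)) → length (preimage σ L) ≤ length L
preimage-length σ []      = z≤n
preimage-length σ (a ∷ L) with any? (λ l → σ l ≟ a)
... | yes _ = s≤s (preimage-length σ L)
... | no  _ = m≤n⇒m≤1+n (preimage-length σ L)

preimage-∈ : ∀ {r k} (σ : Fin r → Fin k) → (∀ x y → σ x ≡ σ y → x ≡ y) →
  ∀ L l → σ l ∈ L → l ∈ preimage σ L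
preimage-∈ σ σ-inj (a ∷ L) l σl∈ with any? (λ l → σ l ≟ a) | σl∈
... | yes (l′ , σl′≡a) | here σl≡a  = here (σ-inj l l′ (≡.trans σl≡a (≡.sym σl′≡a)))
... | yes _            | there σl∈L = there (preimage-∈ σ σ-inj L l σl∈L)
... | no  no-preimage  | here σl≡a  = contradiction (l , σl≡a) no-preimage
... | no  _            | there σl∈L = preimage-∈ σ σ-inj L l σl∈L

injective⇒surjective : ∀ {m} (g : Fin m → Fin m) → (∀ k l → g k ≡ g l → k ≡ l) → ∀ i → ∃[ k ] (g k ≡ i)
injective⇒surjective g g-inj i with any? (λ k → g k ≟ i)
... | yes hit = hit
injective⇒surjective {suc m} g g-inj i | no miss = contradiction (injective⇒≤ g′-inj) 1+n≰n
  where
  -- g misses i, so it factors injectively through Fin m.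
  g′ : Fin (suc m) → Fin m
  g′ k = punchOut {i = i} (λ i≡gk → miss (k , ≡.sym i≡gk))
  g′-inj : ∀ {k l} → g′ k ≡ g′ l → k ≡ l
  g′-inj {k} {l} = g-inj k l ∘
    punchOut-injective {i = i} (λ i≡gk → miss (k , ≡.sym i≡gk)) (λ i≡gl → miss (l , ≡.sym i≡gl))

module Theory {c ℓ} (F : Field c ℓ) where
  open Field F hiding (zero)
  open LinAlg F
  open import Algebra.Properties.Semiring.Sum semiring
    using (sum; sum-cong-≋; sum-replicate-zero; sum-remove; ∑-distrib-+; ∑-comm; *-distribˡ-sum; *-distribʳ-sum)
  open import Algebra.Properties.Ring ring using (-‿distribˡ-*; -‿distribʳ-*)
  open import Algebra.Properties.Group +-group using (inverseˡ-unique)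
  open import Relation.Binary.Reasoning.Setoid setoid

  sum-vanishes : ∀ {n} (f : Vect n) → (∀ i → f i ≈ 0#) → sum f ≈ 0#
  sum-vanishes {n} f h = trans (sum-cong-≋ h) (sum-replicate-zero n)

  sum-single : ∀ {n} (f : Vect n) (k : Fin n) → (∀ j → k ≢ j → f j ≈ 0#) → sum f ≈ f k
  sum-single {suc n} f k h = begin
    sum f                     ≈⟨ sum-remove {i = k} f ⟩
    f k + sum (f ∘ punchIn k) ≈⟨ +-congˡ (sum-vanishes _ (λ j → h _ (punchInᵢ≢i k j ∘ ≡.sym))) ⟩
    f k + 0#                  ≈⟨ +-identityʳ _ ⟩
    f k                       ∎

  δ : ∀ {n} → Fin n → Vect n
  δ a b with a ≟ b
  ... | yes _ = 1#
  ... | no  _ = 0#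

  δ-diag : ∀ {n} (a : Fin n) → δ a a ≈ 1#
  δ-diag a with a ≟ a
  ... | yes _  = refl
  ... | no a≢a = contradiction ≡.refl a≢a

  δ-off : ∀ {n} {a b : Fin n} → a ≢ b → δ a b ≈ 0#
  δ-off {a = a} {b} a≢b with a ≟ b
  ... | yes a≡b = contradiction a≡b a≢b
  ... | no  _   = refl

  δ-sumˡ : ∀ {n} (a : Fin n) (y : Vect n) → sum (λ r → δ a r * y r) ≈ y a
  δ-sumˡ a y = begin
    sum (λ r → δ a r * y r) ≈⟨ sum-single _ a (λ r a≢r → trans (*-congʳ (δ-off a≢r)) (zeroˡ _)) ⟩
    δ a a * y a             ≈⟨ *-congʳ (δ-diag a) ⟩
    1# * y a                ≈⟨ *-identityˡ _ ⟩
    y a                     ∎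

  δ-sumʳ : ∀ {n} (a : Fin n) (y : Vect n) → sum (λ r → y r * δ a r) ≈ y a
  δ-sumʳ a y = trans (sum-cong-≋ (λ r → *-comm (y r) (δ a r))) (δ-sumˡ a y)

  column : ∀ {m n} → Mat m n → Fin n → Vect m
  column A j i = A i j

  ·-δ : ∀ {m n} (A : Mat m n) (j : Fin n) → (A · δ j) ≋ column A j
  ·-δ A j i = δ-sumʳ j (A i)

  lincomb-· : ∀ {p n} (a : Vect p) (M : Mat p n) (x : Vect n) →
    sum (λ l → a l * (M · x) l) ≈ sum (λ j → lincomb a M j * x j)
  lincomb-· {p} {n} a M x = begin
    sum (λ l → a l * sum (λ j → M l j * x j))   ≈⟨ sum-cong-≋ {p} (λ l → *-distribˡ-sum (a l) (λ j → M l j * x j)) ⟩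
    sum (λ l → sum (λ j → a l * (M l j * x j))) ≈⟨ ∑-comm {p} {n} (λ l j → a l * (M l j * x j)) ⟩
    sum (λ j → sum (λ l → a l * (M l j * x j))) ≈⟨ sum-cong-≋ {n} (λ j → sum-cong-≋ {p} (λ l → sym (*-assoc _ _ _))) ⟩
    sum (λ j → sum (λ l → (a l * M l j) * x j)) ≈⟨ sum-cong-≋ {n} (λ j → sym (*-distribʳ-sum (x j) (λ l → a l * M l j))) ⟩
    sum (λ j → lincomb a M j * x j)             ∎

  record InSpan {d m} (b : Fin d → Vect m) (v : Vect m) : Set (c ⊔ ℓ) where
    constructor in-span
    field
      coeffs    : Vect d
      expansion : v ≋ lincomb coeffs b
  open InSpan

  lincomb-congˡ : ∀ {d m} {u u′ : Vect d} (b : Fin d → Vect m) → u ≋ u′ → lincomb u b ≋ lincomb u′ b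
  lincomb-congˡ {d} b u≋u′ j = sum-cong-≋ {d} (λ k → *-congʳ (u≋u′ k))

  lincomb-combine : ∀ {d m} (u v : Vect d) (a : Carrier) (b : Fin d → Vect m) →
    ∀ j → lincomb u b j + a * lincomb v b j ≈ lincomb (λ l → u l + a * v l) b j
  lincomb-combine {d} u v a b j = begin
    sum (λ l → u l * b l j) + a * sum (λ l → v l * b l j)
      ≈⟨ +-congˡ (*-distribˡ-sum a (λ l → v l * b l j)) ⟩
    sum (λ l → u l * b l j) + sum (λ l → a * (v l * b l j))
      ≈⟨ sym (∑-distrib-+ {d} (λ l → u l * b l j) (λ l → a * (v l * b l j))) ⟩
    sum (λ l → u l * b l j + a * (v l * b l j))
      ≈⟨ sum-cong-≋ {d} (λ l → trans (+-congˡ (sym (*-assoc _ _ _))) (sym (distribʳ _ _ _))) ⟩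
    sum (λ l → (u l + a * v l) * b l j) ∎

  span-resp : ∀ {d m} {b : Fin d → Vect m} {u v : Vect m} → u ≋ v → InSpan b u → InSpan b v
  span-resp u≋v (in-span w u≋wb) = in-span w (λ j → trans (sym (u≋v j)) (u≋wb j))

  span-member : ∀ {d m} (b : Fin d → Vect m) (k : Fin d) → InSpan b (b k)
  span-member b k = in-span (δ k) (λ j → sym (δ-sumˡ k (λ l → b l j)))

  span-combine : ∀ {d m} {b : Fin d → Vect m} {u v : Vect m} → InSpan b u → InSpan b v →
    ∀ a → InSpan b (λ j → u j + a * v j)
  span-combine {b = b} (in-span wu u≋) (in-span wv v≋) a =
    in-span (λ l → wu l + a * wv l) (λ j → trans (+-cong (u≋ j) (*-congˡ (v≋ j))) (lincomb-combine wu wv a b j))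

  span-trans : ∀ {d d′ m} {b : Fin d → Vect m} {b′ : Fin d′ → Vect m} {v : Vect m} →
    InSpan b v → (∀ k → InSpan b′ (b k)) → InSpan b′ v
  span-trans {d} {b = b} {b′} {v} (in-span w v≋wb) b⊆b′ = in-span (lincomb w U) λ j → begin
    v j                                     ≈⟨ v≋wb j ⟩
    sum (λ k → w k * b k j)                 ≈⟨ sum-cong-≋ {d} (λ k → *-congˡ (expansion (b⊆b′ k) j)) ⟩
    sum (λ k → w k * (U · column b′ j) k)   ≈⟨ lincomb-· w U (column b′ j) ⟩
    lincomb (lincomb w U) b′ j              ∎
    where
    U : Mat d _
    U k = coeffs (b⊆b′ k)

  lincomb-zero-head : ∀ {d m} (b : Fin (suc d) → Vect m) (w : Vect (suc d)) →
    w zero ≈ 0# → lincomb w b ≋ lincomb (w ∘ suc) (b ∘ suc)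
  lincomb-zero-head b w w₀≈0 j = trans (+-congʳ (trans (*-congʳ w₀≈0) (zeroˡ _))) (+-identityˡ _)

  span-tail : ∀ {d m} (b : Fin (suc d) → Vect m) {v : Vect m} (w : Vect (suc d)) →
    w zero ≈ 0# → v ≋ lincomb w b → InSpan (b ∘ suc) v
  span-tail b w w₀≈0 v≋wb = in-span (w ∘ suc) (λ j → trans (v≋wb j) (lincomb-zero-head b w w₀≈0 j))

  colSpace⇔span : ∀ {m k} (Q : Mat m k) (v : Vect m) → ColSpace Q v ⇔ InSpan (column Q) v
  colSpace⇔span {k = k} Q v = mk⇔
    (λ (x , v≋Qx) → in-span x (λ i → trans (v≋Qx i) (sum-cong-≋ {k} (λ j → *-comm _ _))))
    (λ (in-span x v≋xQ) → x , λ i → trans (v≋xQ i) (sum-cong-≋ {k} (λ j → *-comm _ _)))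

  head-in-span : ∀ {d m} (x : Vect m) (b : Fin d → Vect m) (w : Vect (suc d)) →
    lincomb w (x ∷ᶠ b) ≋ 0v → ¬ (w zero ≈ 0#) → InSpan b x
  head-in-span {d} x b w w·xb≈0 w₀≉0 = in-span (λ l → (- y) * w (suc l)) solve
    where
    y : Carrier
    y = proj₁ (inverse (w zero) w₀≉0)
    w₀y≈1 : w zero * y ≈ 1#
    w₀y≈1 = proj₂ (inverse (w zero) w₀≉0)
    solve : ∀ j → x j ≈ sum (λ l → ((- y) * w (suc l)) * b l j)
    solve j = begin
      x j                               ≈⟨ sym (*-identityˡ _) ⟩
      1# * x j                          ≈⟨ *-congʳ (trans (sym w₀y≈1) (*-comm _ _)) ⟩
      (y * w zero) * x j                ≈⟨ *-assoc _ _ _ ⟩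
      y * (w zero * x j)                ≈⟨ *-congˡ (inverseˡ-unique _ _ (w·xb≈0 j)) ⟩
      y * (- T)                         ≈⟨ sym (-‿distribʳ-* _ _) ⟩
      - (y * T)                         ≈⟨ -‿distribˡ-* _ _ ⟩
      (- y) * T                         ≈⟨ *-distribˡ-sum (- y) (λ l → w (suc l) * b l j) ⟩
      sum (λ l → (- y) * (w (suc l) * b l j)) ≈⟨ sum-cong-≋ {d} (λ l → sym (*-assoc _ _ _)) ⟩
      sum (λ l → ((- y) * w (suc l)) * b l j) ∎
      where
      T : Carrier
      T = sum (λ l → w (suc l) * b l j)

  SpanningSelection : ∀ {k m} → ℕ → (Fin k → Vect m) → Set (c ⊔ ℓ)
  SpanningSelection {k} d q = Σ ℕ λ r → r ≤ d × Σ (Fin r → Fin k) λ σ →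
    (∀ x y → σ x ≡ σ y → x ≡ y) × (∀ j → InSpan (q ∘ σ) (q j))

  weaken-selection : ∀ {k m d} {q : Fin k → Vect m} → SpanningSelection d q → SpanningSelection (suc d) q
  weaken-selection (r , r≤d , rest) = r , m≤n⇒m≤1+n r≤d , rest

  eliminate : ∀ {k m} (q : Fin (suc k) → Vect m) (j₀ : Fin (suc k)) (μ : Vect (suc k)) → Fin k → Vect m
  eliminate q j₀ μ j′ i = q (punchIn j₀ j′) i + (- μ (punchIn j₀ j′)) * q j₀ i

  cancel-multiple : ∀ x y a → (x + (- a) * y) + a * y ≈ x
  cancel-multiple x y a = begin
    (x + (- a) * y) + a * y ≈⟨ +-assoc _ _ _ ⟩
    x + ((- a) * y + a * y) ≈⟨ +-congˡ (sym (distribʳ y (- a) a)) ⟩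
    x + (- a + a) * y       ≈⟨ +-congˡ (trans (*-congʳ (-‿inverseˡ a)) (zeroˡ y)) ⟩
    x + 0#                  ≈⟨ +-identityʳ x ⟩
    x                       ∎

  pivot-extend : ∀ {d k m} (q : Fin (suc k) → Vect m) (j₀ : Fin (suc k)) (μ : Vect (suc k)) →
    SpanningSelection d (eliminate q j₀ μ) → SpanningSelection (suc d) q
  pivot-extend q j₀ μ (r , r≤d , σ′ , σ′-inj , spans′) = suc r , s≤s r≤d , σ , σ-inj , spans
    where
    σ : Fin (suc r) → Fin _
    σ = j₀ ∷ᶠ punchIn j₀ ∘ σ′
    σ-inj : ∀ x y → σ x ≡ σ y → x ≡ y
    σ-inj zero    zero    _ = ≡.refl
    σ-inj zero    (suc y) e = contradiction (≡.sym e) (punchInᵢ≢i j₀ (σ′ y))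
    σ-inj (suc x) zero    e = contradiction e (punchInᵢ≢i j₀ (σ′ x))
    σ-inj (suc x) (suc y) e = ≡.cong suc (σ′-inj x y (punchIn-injective j₀ _ _ e))
    q′ : Fin _ → Vect _
    q′ = eliminate q j₀ μ
    selected : ∀ l → InSpan (q ∘ σ) (q′ (σ′ l))
    selected l = span-combine (span-member (q ∘ σ) (suc l)) (span-member (q ∘ σ) zero) (- μ (punchIn j₀ (σ′ l)))
    eliminated : ∀ j′ → InSpan (q ∘ σ) (q′ j′)
    eliminated j′ = span-trans (spans′ j′) selected
    restored : ∀ j′ → InSpan (q ∘ σ) (q (punchIn j₀ j′))
    restored j′ = span-resp (λ i → cancel-multiple _ (q j₀ i) (μ (punchIn j₀ j′)))
                            (span-combine (eliminated j′) (span-member (q ∘ σ) zero) (μ (punchIn j₀ j′)))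
    spans : ∀ j → InSpan (q ∘ σ) (q j)
    spans j with j₀ ≟ j
    ... | yes ≡.refl = span-member (q ∘ σ) zero
    ... | no  j₀≢j   = ≡.subst (InSpan (q ∘ σ) ∘ q) (punchIn-punchOut j₀≢j) (restored (punchOut j₀≢j))

  -- If the pivot has coefficient w₀ ≠ 0 (with inverse y) on b 0, the multipliers
  -- μ j = W j 0 · y remove b 0 from every eliminated vector.
  eliminate-in-tail : ∀ {d k m} (q : Fin (suc k) → Vect m) (b : Fin (suc d) → Vect m)
    (W : Fin (suc k) → Vect (suc d)) → (∀ j → q j ≋ lincomb (W j) b) →
    (j₀ : Fin (suc k)) (y : Carrier) → W j₀ zero * y ≈ 1# →
    ∀ j′ → InSpan (b ∘ suc) (eliminate q j₀ (λ j → W j zero * y) j′)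
  eliminate-in-tail q b W q≋Wb j₀ y w₀y≈1 j′ =
    span-tail b (λ l → W j l + (- a) * W j₀ l) head-vanishes
      (λ i → trans (+-cong (q≋Wb j i) (*-congˡ (q≋Wb j₀ i))) (lincomb-combine (W j) (W j₀) (- a) b i))
    where
    j : Fin _
    j = punchIn j₀ j′
    a : Carrier
    a = W j zero * y
    head-vanishes : W j zero + (- a) * W j₀ zero ≈ 0#
    head-vanishes = begin
      W j zero + (- a) * W j₀ zero        ≈⟨ +-congˡ (sym (-‿distribˡ-* a (W j₀ zero))) ⟩
      W j zero - (W j zero * y) * W j₀ zero ≈⟨ +-congˡ (-‿cong (*-assoc _ _ _)) ⟩
      W j zero - W j zero * (y * W j₀ zero) ≈⟨ +-congˡ (-‿cong (*-congˡ (trans (*-comm _ _) w₀y≈1))) ⟩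
      W j zero - W j zero * 1#            ≈⟨ +-congˡ (-‿cong (*-identityʳ _)) ⟩
      W j zero - W j zero                 ≈⟨ -‿inverseʳ _ ⟩
      0#                                  ∎

  SparseRow : ∀ {s} → ℕ → Vect s → Set ℓ
  SparseRow {s} t u = ∃[ L ] (length {A = Fin s} L ≤ t × (∀ j → ¬ (j ∈ L) → u j ≈ 0#))

  select-sparse : ∀ {t r s} {u : Vect s} (σ : Fin r → Fin s) → (∀ x y → σ x ≡ σ y → x ≡ y) →
    SparseRow t u → SparseRow t (u ∘ σ)
  select-sparse σ σ-inj (L , |L|≤t , supp) =
    preimage σ L , ≤-trans (preimage-length σ L) |L|≤t ,
    λ l l∉ → supp (σ l) (λ σl∈L → l∉ (preimage-∈ σ σ-inj L l σl∈L))

  pad-sparse : ∀ {t s} {u : Vect s} → SparseRow t u → SparseRow t (0# ∷ᶠ u)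
  pad-sparse (L , |L|≤t , supp) = map suc L , ≤-trans (≤-reflexive (length-map suc L)) |L|≤t , λ where
    zero    _  → refl
    (suc j) j∉ → supp j (λ j∈L → j∉ (∈-map⁺ suc j∈L))

  terms : ∀ {t s} → (Fin t → Fin s) → Vect t → Vect s
  terms ι w = lincomb w (δ ∘ ι)

  terms-sparse : ∀ {t s} (ι : Fin t → Fin s) (w : Vect t) → SparseRow t (terms ι w)
  terms-sparse {t} ι w = tabulate ι , ≤-reflexive (length-tabulate ι) , λ r r∉ →
    sum-vanishes _ (λ l → trans (*-congˡ (δ-off (λ ιl≡r → r∉ (≡.subst (_∈ tabulate ι) ιl≡r (∈-tabulate⁺ l))))) (zeroʳ _))

  lincomb-terms : ∀ {t s n} (ι : Fin t → Fin s) (w : Vect t) (S : Fin s → Vect n) →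
    lincomb (terms ι w) S ≋ lincomb w (S ∘ ι)
  lincomb-terms {t} ι w S j = begin
    sum (λ r → terms ι w r * S r j)            ≈⟨ sym (lincomb-· w (δ ∘ ι) (column S j)) ⟩
    sum (λ l → w l * ((δ ∘ ι) · column S j) l) ≈⟨ sum-cong-≋ {t} (λ l → *-congˡ (δ-sumˡ (ι l) (column S j))) ⟩
    sum (λ l → w l * S (ι l) j)                ∎

  drop-entry : ∀ {s} → Fin s → Vect s → Vect s
  drop-entry a u r with a ≟ r
  ... | yes _ = 0#
  ... | no  _ = u r

  split-entry : ∀ {s} (a : Fin s) (u : Vect s) r → u r ≈ u a * δ a r + drop-entry a u r
  split-entry a u r with a ≟ r
  ... | yes ≡.refl = sym (trans (+-identityʳ _) (*-identityʳ _))
  ... | no  _      = sym (trans (+-congʳ (zeroʳ _)) (+-identityˡ _))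

  drop-entry-support : ∀ {s} (a : Fin s) (L : List (Fin s)) (u : Vect s) →
    (∀ j → ¬ (j ∈ a ∷ L) → u j ≈ 0#) → ∀ j → ¬ (j ∈ L) → drop-entry a u j ≈ 0#
  drop-entry-support a L u supp j j∉L with a ≟ j
  ... | yes _   = refl
  ... | no  a≢j = supp j λ where
    (here j≡a)  → a≢j (≡.sym j≡a)
    (there j∈L) → j∉L j∈L

  list-terms : ∀ {s} (L : List (Fin s)) (u : Vect s) → (∀ j → ¬ (j ∈ L) → u j ≈ 0#) →
    Σ (Fin (length L) → Fin s) λ ι → Σ (Vect (length L)) λ w → u ≋ terms ι w
  list-terms []      u supp = (λ ()) , (λ ()) , λ r → supp r (λ ())
  list-terms (a ∷ L) u supp with list-terms L (drop-entry a u) (drop-entry-support a L u supp)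
  ... | ι , w , u′≋ = (a ∷ᶠ ι) , (u a ∷ᶠ w) , λ r → trans (split-entry a u r) (+-congˡ (u′≋ r))

  pad-terms : ∀ {p t s} → Fin s → p ≤′ t → (ι : Fin p → Fin s) (w : Vect p) →
    Σ (Fin t → Fin s) λ ι′ → Σ (Vect t) λ w′ → terms ι w ≋ terms ι′ w′
  pad-terms r₀ ≤′-refl        ι w = ι , w , λ _ → refl
  pad-terms r₀ (≤′-step p≤′t) ι w with pad-terms r₀ p≤′t ι w
  ... | ι′ , w′ , eq = (r₀ ∷ᶠ ι′) , (0# ∷ᶠ w′) , λ r → trans (eq r) (sym (trans (+-congʳ (zeroˡ _)) (+-identityˡ _)))

  sparse-terms : ∀ {t s} → 1 ≤ s → (u : Vect s) → SparseRow t u →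
    Σ (Fin t → Fin s) λ ι → Σ (Vect t) λ w → u ≋ terms ι w
  sparse-terms (s≤s _) u (L , |L|≤t , supp) with list-terms L u supp
  ... | ι , w , u≋ with pad-terms zero (≤⇒≤′ |L|≤t) ι w
  ... | ι′ , w′ , eq = ι′ , w′ , λ r → trans (u≋ r) (eq r)

  sumset⇔sparse-combination : ∀ {t s n} → 1 ≤ s → (S : Fin s → Vect n) (v : Vect n) →
    InSumset t S v ⇔ (∃[ u ] (SparseRow t u × v ≋ lincomb u S))
  sumset⇔sparse-combination 1≤s S v = mk⇔
    (λ (ι , w , v≋) → terms ι w , terms-sparse ι w , λ j → trans (v≋ j) (sym (lincomb-terms ι w S j)))
    (λ (u , sparse , v≋) → let (ι , w , u≋) = sparse-terms 1≤s u sparse in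
      ι , w , λ j → trans (v≋ j) (trans (lincomb-congˡ S u≋ j) (lincomb-terms ι w S j)))

  factorization⇔rows : ∀ {m s n} (Q : Mat m s) (P : Mat s n) (A : Mat m n) →
    (∀ x → (Q · (P · x)) ≋ (A · x)) ⇔ (∀ i → A i ≋ lincomb (Q i) P)
  factorization⇔rows {s = s} {n} Q P A = mk⇔ rows factorization
    where
    rows : (∀ x → (Q · (P · x)) ≋ (A · x)) → ∀ i → A i ≋ lincomb (Q i) P
    rows QPx≋Ax i j = begin
      A i j                     ≈⟨ sym (·-δ A j i) ⟩
      (A · δ j) i               ≈⟨ sym (QPx≋Ax (δ j) i) ⟩
      (Q · (P · δ j)) i         ≈⟨ sum-cong-≋ {s} (λ r → *-congˡ (·-δ P j r)) ⟩
      sum (λ r → Q i r * P r j) ∎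
    factorization : (∀ i → A i ≋ lincomb (Q i) P) → ∀ x → (Q · (P · x)) ≋ (A · x)
    factorization A≋QP x i = begin
      (Q · (P · x)) i                    ≈⟨ lincomb-· (Q i) P x ⟩
      sum (λ j → lincomb (Q i) P j * x j) ≈⟨ sum-cong-≋ {n} (λ j → *-congʳ (sym (A≋QP i j))) ⟩
      (A · x) i                          ∎

  RowsInSumset : ∀ {m n} → ℕ → ℕ → Mat m n → Set (c ⊔ ℓ)
  RowsInSumset {n = n} s t A = ∃[ S ] (∀ i → InSumset {s} {n} t S (A i))

  -- (1) ⇔ (3) without evasiveness: a data structure A = QP is the same as a set S
  -- (the rows of P) together with t-sparse coefficients (the rows of Q) expressing
  -- every row of A in terms of S.
  ds⇔rowsInSumset : ∀ {m n s t} (A : Mat m n) → 1 ≤ s → LinearDS s t A ⇔ RowsInSumset s t A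
  ds⇔rowsInSumset A 1≤s = mk⇔
    (λ (Q , P , sparse , QP≋A) → P , λ i →
      Equivalence.from (sumset⇔sparse-combination 1≤s P (A i))
        (Q i , sparse i , Equivalence.to (factorization⇔rows Q P A) QP≋A i))
    (λ (S , rows) →
      let sparse-combination i = Equivalence.to (sumset⇔sparse-combination 1≤s S (A i)) (rows i) in
      (λ i → proj₁ (sparse-combination i)) , S , (λ i → proj₁ (proj₂ (sparse-combination i))) ,
      Equivalence.from (factorization⇔rows _ S A) (λ i → proj₂ (proj₂ (sparse-combination i))))

  SparseCover : ∀ {m n} → ℕ → ℕ → Mat m n → Set (c ⊔ ℓ)
  SparseCover {m} k t A = ∃[ Q ] (RowSparse {m} {k} t Q × (∀ v → ColSpace A v → ColSpace Q v))

  -- A data structure A = QP is a sparse cover Q of A: given the cover, P sends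
  -- each standard basis vector eⱼ to the coordinates of the column A eⱼ in Q.
  ds⇔cover : ∀ {m n s t} (A : Mat m n) → LinearDS s t A ⇔ SparseCover s t A
  ds⇔cover A = mk⇔
    (λ (Q , P , sparse , QP≋A) → Q , sparse , λ v (x , v≋Ax) → (P · x) , λ i → trans (v≋Ax i) (sym (QP≋A x i)))
    (λ (Q , sparse , A⊆Q) → let coords j = A⊆Q (column A j) (δ j , λ i → sym (·-δ A j i)) in
      Q , (λ l j → proj₁ (coords j) l) , sparse ,
      Equivalence.from (factorization⇔rows Q _ A) (λ i j → proj₂ (coords j) i))

  cover-pad : ∀ {m n r s t} (A : Mat m n) → r ≤′ s → SparseCover r t A → SparseCover s t A
  cover-pad A ≤′-refl        cover = cover
  cover-pad A (≤′-step r≤′s) cover with cover-pad A r≤′s cover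
  ... | Q , sparse , A⊆Q = (λ i → 0# ∷ᶠ Q i) , (λ i → pad-sparse (sparse i)) , λ v v∈A →
    let (x , v≋Qx) = A⊆Q v v∈A in
    (0# ∷ᶠ x) , λ i → trans (v≋Qx i) (sym (trans (+-congʳ (zeroˡ _)) (+-identityˡ _)))

  dim-resp : ∀ {m d} {U W : Subset m} → (∀ v → U v → W v) → (∀ v → W v → U v) → HasDim U d → HasDim W d
  dim-resp U⊆W W⊆U (b , indep , b∈U , spans) = b , indep , (λ k → U⊆W (b k) (b∈U k)) , (λ v v∈W → spans v (W⊆U v v∈W))

  module Classical (em : ExcludedMiddle (c ⊔ ℓ)) where

    _≈?_ : ∀ x y → Dec (x ≈ y)
    x ≈? y with em {P = Lift c (x ≈ y)}
    ... | yes x≈y = yes (lower x≈y)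
    ... | no  x≉y = no (λ x≈y → x≉y (lift x≈y))

    cons-independent : ∀ {d m} {b : Fin d → Vect m} {x : Vect m} →
      LinIndep b → ¬ InSpan b x → LinIndep (x ∷ᶠ b)
    cons-independent {b = b} {x} indep x∉span w w·xb≈0 with w zero ≈? 0#
    ... | no  w₀≉0 = contradiction (head-in-span x b w w·xb≈0 w₀≉0) x∉span
    ... | yes w₀≈0 = λ where
      zero    → w₀≈0
      (suc k) → indep (w ∘ suc) (λ j → trans (sym (lincomb-zero-head (x ∷ᶠ b) w w₀≈0 j)) (w·xb≈0 j)) k

    independent-subfamily : ∀ {m} k (q : Fin k → Vect m) →
      Σ ℕ λ r → r ≤ k × Σ (Fin r → Fin k) λ σ → LinIndep (q ∘ σ) × (∀ j → InSpan (q ∘ σ) (q j))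
    independent-subfamily zero q = 0 , z≤n , (λ ()) , (λ _ _ ()) , (λ ())
    independent-subfamily (suc k) q with independent-subfamily k (q ∘ suc)
    ... | r , r≤k , σ , indep , spans with em {P = InSpan (q ∘ suc ∘ σ) (q zero)}
    ... | yes q₀∈span = r , m≤n⇒m≤1+n r≤k , suc ∘ σ , indep , λ where
      zero    → q₀∈span
      (suc j) → spans j
    ... | no  q₀∉span = suc r , s≤s r≤k , zero ∷ᶠ suc ∘ σ , cons-independent indep q₀∉span , λ where
      zero    → span-member (q ∘ (zero ∷ᶠ suc ∘ σ)) zero
      (suc j) → span-trans (spans j) (λ l → span-member (q ∘ (zero ∷ᶠ suc ∘ σ)) (suc l))

    colSpace-dim : ∀ {m k} (Q : Mat m k) → Σ ℕ λ r → r ≤ k × HasDim (ColSpace Q) r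
    colSpace-dim {k = k} Q with independent-subfamily k (column Q)
    ... | r , r≤k , σ , indep , spans = r , r≤k , column Q ∘ σ , indep , in-colSpace , spanning
      where
      in-colSpace : ∀ l → ColSpace Q (column Q (σ l))
      in-colSpace l = δ (σ l) , λ i → sym (·-δ Q (σ l) i)
      spanning : ∀ v → ColSpace Q v → ∃[ w ] (v ≋ lincomb w (column Q ∘ σ))
      spanning v v∈ with span-trans (Equivalence.to (colSpace⇔span Q v) v∈) spans
      ... | in-span w v≋w = w , v≋w

    exchange : ∀ d {k m} (q : Fin k → Vect m) (b : Fin d → Vect m) →
      (∀ j → InSpan b (q j)) → SpanningSelection d q
    exchange zero    q b q⊆b = 0 , z≤n , (λ ()) , (λ ()) , λ j → in-span (λ ()) (expansion (q⊆b j))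
    exchange (suc d) {zero} q b q⊆b = 0 , z≤n , (λ ()) , (λ ()) , λ ()
    exchange (suc d) {suc k} q b q⊆b = with-coefficients (coeffs ∘ q⊆b) (expansion ∘ q⊆b)
      where
      -- W j are the coefficients of q j in b; a pivot is a q j₀ with W j₀ 0 ≠ 0.
      with-coefficients : (W : Fin (suc k) → Vect (suc d)) → (∀ j → q j ≋ lincomb (W j) b) →
        SpanningSelection (suc d) q
      with-coefficients W q≋Wb with any? (λ j → ¬? (W j zero ≈? 0#))
      ... | yes (j₀ , w₀≉0) =
        let (y , w₀y≈1) = inverse (W j₀ zero) w₀≉0 in
        pivot-extend q j₀ (λ j → W j zero * y) (exchange d _ (b ∘ suc) (eliminate-in-tail q b W q≋Wb j₀ y w₀y≈1))
      ... | no  no-pivot =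
        weaken-selection (exchange d q (b ∘ suc) (λ j → span-tail b (W j) (no-head j) (q≋Wb j)))
        where
        no-head : ∀ j → W j zero ≈ 0#
        no-head j = decidable-stable (W j zero ≈? 0#) (λ w≉0 → no-pivot (j , w≉0))

    bounded-search : (P : ℕ → Set (c ⊔ ℓ)) → ∀ n →
      (Σ ℕ λ d → P d × d < n × (∀ d′ → P d′ → d ≤ d′)) ⊎ (∀ d → P d → n ≤ d)
    bounded-search P zero = inj₂ (λ _ _ → z≤n)
    bounded-search P (suc n) with bounded-search P n
    ... | inj₁ (d , Pd , d<n , least) = inj₁ (d , Pd , m<n⇒m<1+n d<n , least)
    ... | inj₂ above with em {P = P n}
    ... | yes Pn  = inj₁ (n , Pn , n<1+n n , above)
    ... | no  ¬Pn = inj₂ (λ d Pd → ≤∧≢⇒< (above d Pd) (λ n≡d → ¬Pn (≡.subst P (≡.sym n≡d) Pd)))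

    least-witness : (P : ℕ → Set (c ⊔ ℓ)) → ∀ r → P r → Σ ℕ λ d → P d × d ≤ r × (∀ d′ → P d′ → d ≤ d′)
    least-witness P r Pr with bounded-search P (suc r)
    ... | inj₁ (d , Pd , d<1+r , least) = d , Pd , s≤s⁻¹ d<1+r , least
    ... | inj₂ above                    = contradiction (above r Pr) 1+n≰n

    SparseSuperspaceOfDim : ∀ {m n} → ℕ → Mat m n → ℕ → Set (c ⊔ ℓ)
    SparseSuperspaceOfDim {m} t A d = ∃[ k ] ∃[ Q ]
      (RowSparse {m} {k} t Q × (∀ v → ColSpace A v → ColSpace Q v) × HasDim (ColSpace Q) d)

    -- (1) ⇒ (2): the column space of a sparse cover with s columns has dimension
    -- at most s, so the least dimension of a t-sparse superspace is at most s.
    cover⇒outerDim : ∀ {m n s t} (A : Mat m n) → SparseCover s t A →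
      ∃[ d ] (IsOuterDim (ColSpace A) t d × d ≤ s)
    cover⇒outerDim {s = s} {t} A (Q , sparse , A⊆Q) with colSpace-dim Q
    ... | r , r≤s , dimQ with least-witness (SparseSuperspaceOfDim t A) r (s , Q , sparse , A⊆Q , dimQ)
    ... | d , (k , Q′ , sparse′ , A⊆Q′ , dimQ′) , d≤r , least =
      d , ((ColSpace Q′ , (k , Q′ , sparse′ , λ v → id , id) , A⊆Q′ , dimQ′) , minimal) , ≤-trans d≤r r≤s
      where
      minimal : ∀ U d′ → SparseSubspace t U → (∀ v → ColSpace A v → U v) → HasDim U d′ → d ≤ d′
      minimal U d′ (k₂ , Q₂ , sparse₂ , U⇔Q₂) A⊆U dimU = least d′
        (k₂ , Q₂ , sparse₂ , (λ v v∈A → proj₁ (U⇔Q₂ v) (A⊆U v v∈A)) ,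
         dim-resp (λ v → proj₁ (U⇔Q₂ v)) (λ v → proj₂ (U⇔Q₂ v)) dimU)

    -- (2) ⇒ (1): a t-sparse superspace ColSpace Q of dimension d ≤ s is already
    -- spanned by at most d distinct columns of Q; keeping only those columns gives a
    -- t-row sparse cover, padded with zero columns up to s.
    outerDim⇒cover : ∀ {m n s t d} (A : Mat m n) → IsOuterDim (ColSpace A) t d → d ≤ s → SparseCover s t A
    outerDim⇒cover {d = d} A ((U , (k , Q , sparse , U⇔Q) , A⊆U , (b , _ , _ , U⊆b)) , _) d≤s
      with exchange d (column Q) b columns-in-span
      where
      columns-in-span : ∀ j → InSpan b (column Q j)
      columns-in-span j = let (w , Qj≋wb) = U⊆b _ (proj₂ (U⇔Q _) (δ j , λ i → sym (·-δ Q j i))) in in-span w Qj≋wb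
    ... | r , r≤d , σ , σ-inj , spans = cover-pad A (≤⇒≤′ (≤-trans r≤d d≤s))
      ((λ i → Q i ∘ σ) , (λ i → select-sparse σ σ-inj (sparse i)) , λ v v∈A →
        Equivalence.from (colSpace⇔span _ v)
          (span-trans (Equivalence.to (colSpace⇔span Q v) (proj₁ (U⇔Q v) (A⊆U v v∈A))) spans))

    cover⇔outerDim : ∀ {m n s t} (A : Mat m n) →
      SparseCover s t A ⇔ (∃[ d ] (IsOuterDim (ColSpace A) t d × d ≤ s))
    cover⇔outerDim A = mk⇔ (cover⇒outerDim A) (λ (d , outerDim , d≤s) → outerDim⇒cover A outerDim d≤s)

    -- (1) ⇔ (3) given distinct rows: M is not sumset evasive exactly when some S of
    -- size s has all m rows in tS, since m distinct rows in tS ∩ M are all of M.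
    ¬evasive⇔rowsInSumset : ∀ {m n s t} (A : Mat m n) → (∀ i j → A i ≋ A j → i ≡ j) →
      (¬ SumsetEvasive s t A) ⇔ RowsInSumset s t A
    ¬evasive⇔rowsInSumset {m} {n} {s} {t} A distinct = mk⇔ rows-in-sumset not-evasive
      where
      not-evasive : RowsInSumset s t A → ¬ SumsetEvasive s t A
      not-evasive (S , rows) evasive = evasive S (A , distinct , λ i → rows i , lift (i , λ _ → refl))
      rows-in-sumset : ¬ SumsetEvasive s t A → RowsInSumset s t A
      rows-in-sumset not-evasive with em {P = Σ (Fin s → Vect n) λ S → Σ (Fin m → Vect n) λ f →
                                          (∀ k l → f k ≋ f l → k ≡ l) × (∀ k → InSumset t S (f k) × InRows A (f k))}
      ... | no  none = contradiction (λ S (f , f-inj , f∈) → none (S , f , f-inj , f∈)) not-evasive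
      ... | yes (S , f , f-inj , f∈) = S , λ i →
        let (k , gk≡i) = injective⇒surjective g g-inj i
            (ι , w , fk≋) = proj₁ (f∈ k)
        in ι , w , λ j → trans (reflexive (≡.cong (λ i′ → A i′ j) (≡.sym gk≡i))) (trans (sym (f≋A k j)) (fk≋ j))
        where
        g : Fin m → Fin m
        g k = proj₁ (lower (proj₂ (f∈ k)))
        f≋A : ∀ k → f k ≋ A (g k)
        f≋A k = proj₂ (lower (proj₂ (f∈ k)))
        g-inj : ∀ k l → g k ≡ g l → k ≡ l
        g-inj k l gk≡gl = f-inj k l λ j →
          trans (f≋A k j) (trans (reflexive (≡.cong (λ i → A i j) gk≡gl)) (sym (f≋A l j)))

lemma4p6 : ∀ {c ℓ} (F : Field c ℓ) → ExcludedMiddle (c ⊔ ℓ) →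
    let open LinAlg F in
    ∀ {m n} (A : Mat m n) → (∀ i j → A i ≋ A j → i ≡ j) →
    ∀ (s t : ℕ) → 1 ≤ s → 1 ≤ t →
    (LinearDS s t A ⇔ (∃[ d ] (IsOuterDim (ColSpace A) t d × d ≤ s)))
    × ((∃[ d ] (IsOuterDim (ColSpace A) t d × d ≤ s)) ⇔ (¬ SumsetEvasive s t A))
lemma4p6 F em A distinct s t 1≤s _ = ds⇔outerDim , outerDim⇔¬evasive
  where
  open LinAlg F
  open Theory F
  open Classical em

  ds⇔outerDim : LinearDS s t A ⇔ (∃[ d ] (IsOuterDim (ColSpace A) t d × d ≤ s))
  ds⇔outerDim = cover⇔outerDim A ⇔-∘ ds⇔cover A

  outerDim⇔¬evasive : (∃[ d ] (IsOuterDim (ColSpace A) t d × d ≤ s)) ⇔ (¬ SumsetEvasive s t A)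
  outerDim⇔¬evasive =
    ⇔-sym (¬evasive⇔rowsInSumset A distinct) ⇔-∘ (ds⇔rowsInSumset A 1≤s ⇔-∘ ⇔-sym ds⇔outerDim)
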